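{- For all positive integers $n,k$, \[ f(n,k)\le\sum_{m=1}^{k-1}g(n,m)+kn. \]
   Context: An antichain in $2^{[n]}$ (where $[n]=\{1,\dots,n\}$) is a family of subsets of $[n]$ none of which is contained in another. There is an unknown antichain $\mathcal{S}\subseteq 2^{[n]}$ with exactly $k$ members. A query is a set $Q\subseteq[n]$, answered YES if $Q\supseteq S$ for some $S\in\mathcal{S}$ and NO otherwise. $f(n,k)$ is the smallest $q$ such that some adaptive strategy (queries may depend on previous answers) determines every $k$-member antichain $\mathcal{S}$ uniquely using at most $q$ queries in the worst case. For a family $\mathcal{F}\subseteq 2^{[n]}$, a set $A\subseteq[n]$ is a cover of $\mathcal{F}$ if $A\cap F\ne\emptyset$ for all $F\in\mathcal{F}$; it is a minimal cover if it is a cover and no proper subset of it is a cover. $MC(\mathcal{F})$ denotes the family of minimal covers of $\mathcal{F}$, and $g(n,m)=\max\{|MC(\mathcal{F})| : \mathcal{F}\subseteq 2^{[n]},\ |\mathcal{F}|=m\}$. -}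

module Defs where

open import Data.Nat using (ℕ; zero; suc; _+_; _≤_)
open import Data.Bool using (Bool)
open import Data.Fin using (Fin)
open import Data.Fin.Subset using (Subset; _⊆_; _⊂_; _∩_; Nonempty)
open import Data.Fin.Subset.Properties using (_⊆?_)
open import Data.List using (List; []; _∷_; length)
open import Data.List.Relation.Unary.Any using (any?)
open import Data.List.Relation.Unary.Unique.Propositional using (Unique)
open import Data.List.Membership.Propositional renaming (_∈_ to _∈ᴸ_)
open import Data.Product using (Σ; ∃; _×_)
open import Data.Sum using (_⊎_)
open import Relation.Binary.PropositionalEquality using (_≡_)
open import Relation.Nullary using (¬_; does)
open import Function.Bundles using (_⇔_)

-- A family of subsets of [n] = Fin n is represented by a duplicate-free
-- list of subsets; it has m members iff the list has length m.
IsFamily : (n m : ℕ) → List (Subset n) → Set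
IsFamily n m 𝓕 = Unique 𝓕 × length 𝓕 ≡ m

IsAntichain : (n k : ℕ) → List (Subset n) → Set
IsAntichain n k 𝓢 =
  IsFamily n k 𝓢 × (∀ S T → S ∈ᴸ 𝓢 → T ∈ᴸ 𝓢 → S ⊆ T → S ≡ T)

SameFamily : ∀ {n} → List (Subset n) → List (Subset n) → Set
SameFamily {n} 𝓢 𝓢′ = (X : Subset n) → (X ∈ᴸ 𝓢) ⇔ (X ∈ᴸ 𝓢′)

answer : ∀ {n} → List (Subset n) → Subset n → Bool
answer 𝓢 Q = does (any? (λ S → S ⊆? Q) 𝓢)

data Strategy (n : ℕ) : Set where
  stop : Strategy n
  ask  : Subset n → (ifYes ifNo : Strategy n) → Strategy n

run : ∀ {n} → Strategy n → List (Subset n) → List Bool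
run stop 𝓢 = []
run (ask Q y no) 𝓢 with answer 𝓢 Q
... | Bool.true  = Bool.true ∷ run y 𝓢
... | Bool.false = Bool.false ∷ run no 𝓢

Determines : (n k : ℕ) → Strategy n → Set
Determines n k T = ∀ 𝓢 𝓢′ → IsAntichain n k 𝓢 → IsAntichain n k 𝓢′ →
  run T 𝓢 ≡ run T 𝓢′ → SameFamily 𝓢 𝓢′

-- f(n,k) ≤ q : some strategy determines every k-member antichain using
-- at most q queries in the worst case
f≤ : (n k q : ℕ) → Set
f≤ n k q = Σ (Strategy n) λ T → Determines n k T ×
  (∀ 𝓢 → IsAntichain n k 𝓢 → length (run T 𝓢) ≤ q)

IsCover : ∀ {n} → List (Subset n) → Subset n → Set
IsCover 𝓕 A = ∀ F → F ∈ᴸ 𝓕 → Nonempty (A ∩ F)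

IsMinCover : ∀ {n} → List (Subset n) → Subset n → Set
IsMinCover 𝓕 A = IsCover 𝓕 A × (∀ B → B ⊂ A → ¬ IsCover 𝓕 B)

-- |MC(𝓕)| = c : MC(𝓕) is listed without repetition by a list of length c
CardMC : ∀ {n} → List (Subset n) → ℕ → Set
CardMC {n} 𝓕 c = Σ (List (Subset n)) λ L →
  Unique L × length L ≡ c × ((A : Subset n) → (A ∈ᴸ L) ⇔ IsMinCover 𝓕 A)

-- G m = g(n,m) = max |MC(𝓕)| over 𝓕 ⊆ 2^[n] with |𝓕| = m
-- (convention: 0 if there is no such 𝓕, which only happens for m > 2^n)
IsMaxMC : (n m G : ℕ) → Set
IsMaxMC n m G =
  (∀ 𝓕 c → IsFamily n m 𝓕 → CardMC 𝓕 c → c ≤ G) ×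
  ((Σ (List (Subset n)) λ 𝓕 → IsFamily n m 𝓕 × CardMC 𝓕 G) ⊎ G ≡ 0)

sum1to : (ℕ → ℕ) → ℕ → ℕ
sum1to G zero = 0
sum1to G (suc j) = sum1to G j + G (suc j)

{-# OPTIONS --safe #-}
-- The strategy learns the members of 𝓢 one at a time. Shrinking a YES set greedily, one element at a
-- time and keeping each removal the oracle still answers YES to, costs n queries and ends in a member
-- of 𝓢. If R ⊊ 𝓢 has been learned and S ∈ 𝓢 ∖ R, then no F ∈ R lies inside S (antichain), so the
-- complement of S covers R and contains a minimal cover A of R; thus the complement of A gets a YES.
-- Conversely, a YES to the complement of a cover A of R exhibits a member disjoint from A, hence
-- outside R. So querying complements of the minimal covers of R until a YES and then shrinking costs
-- at most |MC(R)| + n ≤ g(n, |R|) + n queries per new member, after n queries for the first one.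
module Submission where

open import Defs
open import Level using (Level)
open import Data.Nat using (ℕ; _+_; _*_; _∸_; _≤_)
open import Data.Nat.Base using (zero; suc; _<_; s≤s; z≤n)
open import Data.Nat.Properties
  using (≤-refl; ≤-trans; <⇒≤; ≤-reflexive; <-irrefl; ≤⇒≯; +-mono-≤; +-monoˡ-≤; +-monoʳ-≤; +-comm; +-identityʳ;
         m≤n+m; +-commutativeSemigroup; module ≤-Reasoning)
open import Algebra.Properties.CommutativeSemigroup +-commutativeSemigroup using (interchange)
open import Data.Bool using (Bool; true; false; if_then_else_; _≟_)
open import Data.Fin using (Fin)
open import Data.Fin.Subset using (Subset; _⊆_; _⊂_; _∩_; _∈_; _∉_; _─_; _-_; ⁅_⁆; ∁; ⊤; inside; outside)
open import Data.Fin.Subset.Properties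
  using (_∈?_; _⊆?_; _⊂?_; nonempty?; anySubset?; p─q⊆p; x∈p∧x≢y⇒x∈p-y; x∈⁅x⁆; ⊆-refl; ⊆-trans; ⊆-antisym; ⊆-max;
         x∈p∩q⁺; x∈p∩q⁻; x∈∁p⇒x∉p; x∉p⇒x∈∁p)
open import Data.Vec.Base using ([]; _∷_; here; there)
open import Data.Vec.Properties using (∷-injective; ≡-dec)
open import Data.List using (List; []; _∷_; length; filter; allFin; cartesianProductWith)
open import Data.List.Properties using (length-tabulate; ∷-injectiveʳ)
import Data.List.Fresh as List#
open import Data.List.Fresh using (fromList)
import Data.List.Fresh.Membership.Setoid as Membership#
import Data.List.Fresh.Membership.Setoid.Properties as Membership#ₚ
import Data.List.Fresh.Relation.Unary.Any as Any#
open import Data.List.Relation.Unary.Any as Any using (Any; here; there; any?)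
open import Data.List.Relation.Unary.All as All using (all?)
open import Data.List.Relation.Unary.All.Properties using (¬Any⇒All¬)
open import Data.List.Relation.Unary.Unique.Propositional using (Unique; []; _∷_)
open import Data.List.Relation.Unary.Unique.Propositional.Properties using (filter⁺; cartesianProductWith⁺)
open import Data.List.Relation.Binary.Subset.Propositional using () renaming (_⊆_ to _⊆ᴸ_)
open import Data.List.Membership.Propositional using (find; lose) renaming (_∈_ to _∈ᴸ_; _∉_ to _∉ᴸ_)
import Data.List.Membership.DecPropositional as DecMembership
open import Data.List.Membership.Propositional.Properties
  using (∈-allFin; ∈-filter⁺; ∈-filter⁻; ∈-cartesianProductWith⁺)
open import Data.Product using (∃; ∃₂; _×_; _,_; proj₁; proj₂)
open import Function using (id; _∘_)
open import Function.Bundles using (_⇔_; mk⇔; Equivalence)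
import Function.Properties.Equivalence as ⇔
open import Relation.Binary.Definitions using (DecidableEquality; _Respects_)
open import Relation.Binary.PropositionalEquality
  using (_≡_; refl; sym; trans; cong; subst; subst₂; setoid)
open import Relation.Nullary using (¬_; ¬?; yes; no; does; contradiction)
open import Relation.Nullary.Decidable using (decidable-stable; _×-dec_; map′)
open import Relation.Unary using (Pred; Decidable)

private
  variable
    ℓ : Level
    n : ℕ
    A B : Set

x∈p─q⇒x∉q : ∀ {n} {x : Fin n} (p q : Subset n) → x ∈ p ─ q → x ∉ q
x∈p─q⇒x∉q (inside ∷ p) (outside ∷ q) here ()
x∈p─q⇒x∉q (_ ∷ p) (_ ∷ q) (there x∈p─q) (there x∈q) = x∈p─q⇒x∉q p q x∈p─q x∈q

x∉p-x : ∀ {p : Subset n} {x} → x ∉ p - x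
x∉p-x {p = p} {x} x∈p-x = x∈p─q⇒x∉q p ⁅ x ⁆ x∈p-x (x∈⁅x⁆ x)

p⊆q⇒p-x⊆q-x : ∀ {p q : Subset n} {x} → p ⊆ q → p - x ⊆ q - x
p⊆q⇒p-x⊆q-x {p = p} {x = x} p⊆q y∈p-x =
  x∈p∧x≢y⇒x∈p-y (p⊆q (p─q⊆p p ⁅ x ⁆ y∈p-x)) λ { refl → x∉p-x y∈p-x }

p⊆q∧x∉p⇒p⊆q-x : ∀ {p q : Subset n} {x} → p ⊆ q → x ∉ p → p ⊆ q - x
p⊆q∧x∉p⇒p⊆q-x p⊆q x∉p y∈p = x∈p∧x≢y⇒x∈p-y (p⊆q y∈p) λ { refl → x∉p y∈p }

p⊆∁q⇒q⊆∁p : ∀ {p q : Subset n} → p ⊆ ∁ q → q ⊆ ∁ p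
p⊆∁q⇒q⊆∁p p⊆∁q x∈q = x∉p⇒x∈∁p λ x∈p → x∈∁p⇒x∉p (p⊆∁q x∈p) x∈q

-- A unique list is a fresh list for _≢_, so the pigeonhole lemmas for fresh lists apply.
module _ {A : Set} where
  open Membership# (setoid A) renaming (_∈_ to _∈#_)
  open Membership#ₚ (setoid A) using (injection; strict-injection)

  private
    length-fromList : ∀ {xs : List A} (xs! : Unique xs) → List#.length (fromList xs!) ≡ length xs
    length-fromList []        = refl
    length-fromList (_ ∷ xs!) = cong suc (length-fromList xs!)

    ∈-fromList⁺ : ∀ {x} {xs : List A} (xs! : Unique xs) → x ∈ᴸ xs → x ∈# fromList xs!
    ∈-fromList⁺ (_ ∷ _)   (here x≡y)  = Any#.here x≡y
    ∈-fromList⁺ (_ ∷ xs!) (there x∈xs) = Any#.there (∈-fromList⁺ xs! x∈xs)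

    ∈-fromList⁻ : ∀ {x} {xs : List A} (xs! : Unique xs) → x ∈# fromList xs! → x ∈ᴸ xs
    ∈-fromList⁻ (_ ∷ _)   (Any#.here x≡y)  = here x≡y
    ∈-fromList⁻ (_ ∷ xs!) (Any#.there x∈xs) = there (∈-fromList⁻ xs! x∈xs)

  module _ {xs ys : List A} (xs! : Unique xs) (ys! : Unique ys) where

    unique-⊆⇒length-≤ : xs ⊆ᴸ ys → length xs ≤ length ys
    unique-⊆⇒length-≤ xs⊆ys = subst₂ _≤_ (length-fromList xs!) (length-fromList ys!)
      (injection id (∈-fromList⁺ ys! ∘ xs⊆ys ∘ ∈-fromList⁻ xs!))

    unique-⊆∧∉⇒length-< : xs ⊆ᴸ ys → ∀ {y} → y ∈ᴸ ys → y ∉ᴸ xs → length xs < length ys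
    unique-⊆∧∉⇒length-< xs⊆ys y∈ys y∉xs = subst₂ _<_ (length-fromList xs!) (length-fromList ys!)
      (strict-injection id (∈-fromList⁺ ys! ∘ xs⊆ys ∘ ∈-fromList⁻ xs!)
        (_ , ∈-fromList⁺ ys! y∈ys , y∉xs ∘ ∈-fromList⁻ xs!))

  module _ (_≟_ : DecidableEquality A) {xs ys : List A} (xs! : Unique xs) (ys! : Unique ys) where
    open DecMembership _≟_ using () renaming (_∈?_ to _∈ᴸ?_)

    unique-⊆∧length-≡⇒⊇ : xs ⊆ᴸ ys → length xs ≡ length ys → ys ⊆ᴸ xs
    unique-⊆∧length-≡⇒⊇ xs⊆ys |xs|≡|ys| {y} y∈ys = decidable-stable (y ∈ᴸ? xs) λ y∉xs →
      <-irrefl |xs|≡|ys| (unique-⊆∧∉⇒length-< xs! ys! xs⊆ys y∈ys y∉xs)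

    length-<⇒∃∉ : length xs < length ys → ∃ λ y → y ∈ᴸ ys × y ∉ᴸ xs
    length-<⇒∃∉ |xs|<|ys| = find (decidable-stable (any? (λ y → ¬? (y ∈ᴸ? xs)) ys) λ none →
      ≤⇒≯ (unique-⊆⇒length-≤ ys! xs! λ {y} y∈ys → decidable-stable (y ∈ᴸ? xs) (none ∘ lose y∈ys)) |xs|<|ys|)

-- Stated so that IsMinCover 𝓕 is definitionally Minimal (IsCover 𝓕).
Minimal : Pred (Subset n) ℓ → Pred (Subset n) ℓ
Minimal P A = P A × (∀ B → B ⊂ A → ¬ P B)

minimal⇒⊆ : ∀ {P : Pred (Subset n) ℓ} {A B} → Minimal P A → B ⊆ A → P B → A ⊆ B
minimal⇒⊆ {B = B} (_ , A-minimal) B⊆A PB {x} x∈A =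
  decidable-stable (x ∈? B) λ x∉B → A-minimal B (B⊆A , x , x∈A , x∉B) PB

module Shrink {P : Pred (Subset n) ℓ} (P? : Decidable P) where

  shrink : List (Fin n) → Subset n → Subset n
  shrink []       C = C
  shrink (i ∷ is) C = shrink is (if does (P? (C - i)) then C - i else C)

  shrink-⊆ : ∀ is C → shrink is C ⊆ C
  shrink-⊆ []       C = ⊆-refl
  shrink-⊆ (i ∷ is) C with P? (C - i)
  ... | yes _ = ⊆-trans (shrink-⊆ is (C - i)) (p─q⊆p C ⁅ i ⁆)
  ... | no  _ = shrink-⊆ is C

  shrink-satisfies : ∀ is {C} → P C → P (shrink is C)
  shrink-satisfies []       PC = PC
  shrink-satisfies (i ∷ is) {C} PC with P? (C - i)
  ... | yes PC-i = shrink-satisfies is PC-i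
  ... | no  _    = shrink-satisfies is PC

  module _ (P-upward : P Respects _⊆_) where

    shrink-irreducible : ∀ is C {i} → i ∈ᴸ is → i ∈ shrink is C → ¬ P (shrink is C - i)
    shrink-irreducible (i ∷ is) C (here refl) i∈shrink with P? (C - i)
    ... | yes _     = λ _ → x∉p-x (shrink-⊆ is (C - i) i∈shrink)
    ... | no  ¬PC-i = ¬PC-i ∘ P-upward (p⊆q⇒p-x⊆q-x (shrink-⊆ is C))
    shrink-irreducible (_ ∷ is) C (there i∈is) = shrink-irreducible is _ i∈is

    shrink-minimal : ∀ {C} → P C → Minimal P (shrink (allFin n) C)
    shrink-minimal {C} PC = shrink-satisfies (allFin n) PC , λ where
      B (B⊆R , x , x∈R , x∉B) PB → shrink-irreducible (allFin n) C (∈-allFin x) x∈R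
        (P-upward (p⊆q∧x∉p⇒p⊆q-x B⊆R x∉B) PB)

Yes : List (Subset n) → Pred (Subset n) _
Yes 𝓢 Q = Any (_⊆ Q) 𝓢

-- answer 𝓢 Q is definitionally does (yes? 𝓢 Q).
yes? : (𝓢 : List (Subset n)) → Decidable (Yes 𝓢)
yes? 𝓢 Q = any? (_⊆? Q) 𝓢

Yes-upward : (𝓢 : List (Subset n)) → Yes 𝓢 Respects _⊆_
Yes-upward 𝓢 Q⊆Q′ = Any.map λ S⊆Q {x} x∈S → Q⊆Q′ (S⊆Q x∈S)

nonempty⇒Yes-⊤ : ∀ {𝓢 : List (Subset n)} → 0 < length 𝓢 → Yes 𝓢 ⊤
nonempty⇒Yes-⊤ {𝓢 = S ∷ _} _ = here (⊆-max S)

minimal-Yes⇒∈ : ∀ {𝓢 : List (Subset n)} {C} → Minimal (Yes 𝓢) C → C ∈ᴸ 𝓢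
minimal-Yes⇒∈ {𝓢 = 𝓢} C-minimal with find (proj₁ C-minimal)
... | S , S∈𝓢 , S⊆C = subst (_∈ᴸ 𝓢) (⊆-antisym S⊆C (minimal⇒⊆ C-minimal S⊆C (lose S∈𝓢 ⊆-refl))) S∈𝓢

isCover? : (𝓕 : List (Subset n)) → Decidable (IsCover 𝓕)
isCover? 𝓕 A = map′ (λ meets F → All.lookup meets) (λ cover → All.tabulate (cover _))
  (all? (λ F → nonempty? (A ∩ F)) 𝓕)

isMinCover? : (𝓕 : List (Subset n)) → Decidable (IsMinCover 𝓕)
isMinCover? 𝓕 A = isCover? 𝓕 A ×-dec map′
  (λ ¬smaller B B⊂A B-cover → ¬smaller (B , B⊂A , B-cover))
  (λ no-smaller (B , B⊂A , B-cover) → no-smaller B B⊂A B-cover)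
  (¬? (anySubset? λ B → B ⊂? A ×-dec isCover? 𝓕 B))

IsCover-upward : (𝓕 : List (Subset n)) → IsCover 𝓕 Respects _⊆_
IsCover-upward 𝓕 A⊆B A-cover F F∈𝓕 with A-cover F F∈𝓕
... | x , x∈A∩F with x∈p∩q⁻ _ F x∈A∩F
... | x∈A , x∈F = x , x∈p∩q⁺ (A⊆B x∈A , x∈F)

∃-minimalCover-⊆ : ∀ (𝓕 : List (Subset n)) {C} → IsCover 𝓕 C → ∃ λ A → IsMinCover 𝓕 A × A ⊆ C
∃-minimalCover-⊆ 𝓕 {C} C-cover =
  shrink (allFin _) C , shrink-minimal (IsCover-upward 𝓕) C-cover , shrink-⊆ (allFin _) C
  where open Shrink (isCover? 𝓕)

⊈⇒∁-cover : ∀ (𝓕 : List (Subset n)) {S} → (∀ F → F ∈ᴸ 𝓕 → ¬ F ⊆ S) → IsCover 𝓕 (∁ S)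
⊈⇒∁-cover 𝓕 {S} F⊈S F F∈𝓕 = decidable-stable (nonempty? (∁ S ∩ F)) λ ∁S∩F-empty →
  F⊈S F F∈𝓕 λ {x} x∈F → decidable-stable (x ∈? S) λ x∉S →
    ∁S∩F-empty (x , x∈p∩q⁺ (x∉p⇒x∈∁p x∉S , x∈F))

cover⇒⊆∁-∉ : ∀ {𝓕 : List (Subset n)} {A C} → IsCover 𝓕 A → C ⊆ ∁ A → C ∉ᴸ 𝓕
cover⇒⊆∁-∉ A-cover C⊆∁A C∈𝓕 with A-cover _ C∈𝓕
... | x , x∈A∩C with x∈p∩q⁻ _ _ x∈A∩C
... | x∈A , x∈C = x∈∁p⇒x∉p (C⊆∁A x∈C) x∈A

sides : List Bool
sides = inside ∷ outside ∷ []

subsets : ∀ n → List (Subset n)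
subsets zero    = [] ∷ []
subsets (suc n) = cartesianProductWith _∷_ sides (subsets n)

∈-subsets : (p : Subset n) → p ∈ᴸ subsets n
∈-subsets []            = here refl
∈-subsets (inside  ∷ p) = ∈-cartesianProductWith⁺ _∷_ {xs = sides} (here refl) (∈-subsets p)
∈-subsets (outside ∷ p) = ∈-cartesianProductWith⁺ _∷_ {xs = sides} (there (here refl)) (∈-subsets p)

subsets-unique : ∀ n → Unique (subsets n)
subsets-unique zero    = All.[] ∷ []
subsets-unique (suc n) = cartesianProductWith⁺ _∷_ ∷-injective
  (((λ ()) All.∷ All.[]) ∷ All.[] ∷ []) (subsets-unique n)

minimalCovers : List (Subset n) → List (Subset n)
minimalCovers 𝓕 = filter (isMinCover? 𝓕) (subsets _)

∈-minimalCovers⇔ : ∀ (𝓕 : List (Subset n)) A → A ∈ᴸ minimalCovers 𝓕 ⇔ IsMinCover 𝓕 A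
∈-minimalCovers⇔ {n} 𝓕 A = mk⇔ (proj₂ ∘ ∈-filter⁻ (isMinCover? 𝓕) {xs = subsets n})
  (∈-filter⁺ (isMinCover? 𝓕) (∈-subsets A))

minimalCovers-card : (𝓕 : List (Subset n)) → CardMC 𝓕 (length (minimalCovers 𝓕))
minimalCovers-card {n} 𝓕 =
  minimalCovers 𝓕 , filter⁺ (isMinCover? 𝓕) (subsets-unique n) , refl , ∈-minimalCovers⇔ 𝓕

data Query (n : ℕ) (A : Set) : Set where
  pure  : A → Query n A
  query : Subset n → (Bool → Query n A) → Query n A

module _ {n : ℕ} where

  strategy : Query n A → Strategy n
  strategy (pure _)    = stop
  strategy (query Q k) = ask Q (strategy (k true)) (strategy (k false))

  result : Query n A → List (Subset n) → A
  result (pure a)    𝓢 = a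
  result (query Q k) 𝓢 = result (k (answer 𝓢 Q)) 𝓢

  cost : Query n A → List (Subset n) → ℕ
  cost (pure _)    𝓢 = 0
  cost (query Q k) 𝓢 = suc (cost (k (answer 𝓢 Q)) 𝓢)

  length-run : ∀ (p : Query n A) 𝓢 → length (run (strategy p) 𝓢) ≡ cost p 𝓢
  length-run (pure _)    𝓢 = refl
  length-run (query Q k) 𝓢 with answer 𝓢 Q
  ... | true  = cong suc (length-run (k true) 𝓢)
  ... | false = cong suc (length-run (k false) 𝓢)

  run-≡⇒result-≡ : ∀ (p : Query n A) {𝓢 𝓢′} → run (strategy p) 𝓢 ≡ run (strategy p) 𝓢′ → result p 𝓢 ≡ result p 𝓢′
  run-≡⇒result-≡ (pure _)    _ = refl
  run-≡⇒result-≡ (query Q k) {𝓢} {𝓢′} same with answer 𝓢 Q | answer 𝓢′ Q | same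
  ... | true  | true  | same′ = run-≡⇒result-≡ (k true)  (∷-injectiveʳ same′)
  ... | false | false | same′ = run-≡⇒result-≡ (k false) (∷-injectiveʳ same′)
  ... | true  | false | ()
  ... | false | true  | ()

  _>>=_ : Query n A → (A → Query n B) → Query n B
  pure a    >>= f = f a
  query Q k >>= f = query Q (λ b → k b >>= f)

  _<$>_ : (A → B) → Query n A → Query n B
  f <$> pure a    = pure (f a)
  f <$> query Q k = query Q (λ b → f <$> k b)

  result-<$> : ∀ (f : A → B) p 𝓢 → result (f <$> p) 𝓢 ≡ f (result p 𝓢)
  result-<$> f (pure a)    𝓢 = refl
  result-<$> f (query Q k) 𝓢 = result-<$> f (k (answer 𝓢 Q)) 𝓢

  cost-<$> : ∀ (f : A → B) p 𝓢 → cost (f <$> p) 𝓢 ≡ cost p 𝓢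
  cost-<$> f (pure a)    𝓢 = refl
  cost-<$> f (query Q k) 𝓢 = cong suc (cost-<$> f (k (answer 𝓢 Q)) 𝓢)

  result->>= : ∀ p (f : A → Query n B) 𝓢 → result (p >>= f) 𝓢 ≡ result (f (result p 𝓢)) 𝓢
  result->>= (pure a)    f 𝓢 = refl
  result->>= (query Q k) f 𝓢 = result->>= (k (answer 𝓢 Q)) f 𝓢

  cost->>= : ∀ p (f : A → Query n B) 𝓢 → cost (p >>= f) 𝓢 ≡ cost p 𝓢 + cost (f (result p 𝓢)) 𝓢
  cost->>= (pure a)    f 𝓢 = refl
  cost->>= (query Q k) f 𝓢 = cong suc (cost->>= (k (answer 𝓢 Q)) f 𝓢)

module _ {n : ℕ} where

  shrinkQuery : List (Fin n) → Subset n → Query n (Subset n)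
  shrinkQuery []       C = pure C
  shrinkQuery (i ∷ is) C = query (C - i) λ b → shrinkQuery is (if b then C - i else C)

  result-shrinkQuery : ∀ is C 𝓢 → result (shrinkQuery is C) 𝓢 ≡ Shrink.shrink (yes? 𝓢) is C
  result-shrinkQuery []       C 𝓢 = refl
  result-shrinkQuery (i ∷ is) C 𝓢 = result-shrinkQuery is _ 𝓢

  cost-shrinkQuery : ∀ is C 𝓢 → cost (shrinkQuery is C) 𝓢 ≡ length is
  cost-shrinkQuery []       C 𝓢 = refl
  cost-shrinkQuery (i ∷ is) C 𝓢 = cong suc (cost-shrinkQuery is _ 𝓢)

  minimalYes : Subset n → Query n (Subset n)
  minimalYes = shrinkQuery (allFin n)

  minimalYes-∈ : ∀ {𝓢 C} → Yes 𝓢 C → result (minimalYes C) 𝓢 ∈ᴸ 𝓢 × result (minimalYes C) 𝓢 ⊆ C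
  minimalYes-∈ {𝓢} {C} Yes-C rewrite result-shrinkQuery (allFin n) C 𝓢 =
    minimal-Yes⇒∈ (shrink-minimal (Yes-upward 𝓢) Yes-C) , shrink-⊆ (allFin n) C
    where open Shrink (yes? 𝓢)

  cost-minimalYes : ∀ C 𝓢 → cost (minimalYes C) 𝓢 ≡ n
  cost-minimalYes C 𝓢 = trans (cost-shrinkQuery (allFin n) C 𝓢) (length-tabulate id)

  grow : List (Subset n) → List (Subset n) → Query n (List (Subset n))
  grow R []       = pure R
  grow R (A ∷ As) = query (∁ A) λ b → if b then (_∷ R) <$> minimalYes (∁ A) else grow R As

  cost-grow : ∀ R As 𝓢 → cost (grow R As) 𝓢 ≤ length As + n
  cost-grow R []       𝓢 = z≤n
  cost-grow R (A ∷ As) 𝓢 with answer 𝓢 (∁ A)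
  ... | true  = s≤s (≤-trans (≤-reflexive cost-found) (m≤n+m n (length As)))
    where
    cost-found : cost ((_∷ R) <$> minimalYes (∁ A)) 𝓢 ≡ n
    cost-found = trans (cost-<$> (_∷ R) (minimalYes (∁ A)) 𝓢) (cost-minimalYes (∁ A) 𝓢)
  ... | false = s≤s (cost-grow R As 𝓢)

  grow-finds-member : ∀ R As 𝓢 → Any (λ A → Yes 𝓢 (∁ A)) As →
    ∃₂ λ A C → A ∈ᴸ As × C ∈ᴸ 𝓢 × C ⊆ ∁ A × result (grow R As) 𝓢 ≡ C ∷ R
  grow-finds-member R (A ∷ As) 𝓢 some with yes? 𝓢 (∁ A) | some
  ... | yes Yes-∁A | _ = A , _ , here refl , proj₁ (minimalYes-∈ Yes-∁A) , proj₂ (minimalYes-∈ Yes-∁A) ,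
    result-<$> (_∷ R) (minimalYes (∁ A)) 𝓢
  ... | no ¬Yes-∁A | here Yes-∁A = contradiction Yes-∁A ¬Yes-∁A
  ... | no _       | there some′ with grow-finds-member R As 𝓢 some′
  ...   | A′ , C , A′∈As , found = A′ , C , there A′∈As , found

  learn : ℕ → Query n (List (Subset n))
  learn zero    = (_∷ []) <$> minimalYes ⊤
  learn (suc j) = learn j >>= λ R → grow R (minimalCovers R)

module Learning {n k : ℕ} {𝓢 : List (Subset n)} (𝓢-antichain : IsAntichain n k 𝓢) where

  private
    𝓢-unique : Unique 𝓢
    𝓢-unique = proj₁ (proj₁ 𝓢-antichain)

    length-𝓢 : length 𝓢 ≡ k
    length-𝓢 = proj₂ (proj₁ 𝓢-antichain)

  Learned : ℕ → List (Subset n) → Set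
  Learned j R = IsFamily n (suc j) R × R ⊆ᴸ 𝓢

  learned-∷ : ∀ {j R C} → Learned j R → C ∈ᴸ 𝓢 → C ∉ᴸ R → Learned (suc j) (C ∷ R)
  learned-∷ ((R-unique , length-R) , R⊆𝓢) C∈𝓢 C∉R =
    (¬Any⇒All¬ _ C∉R ∷ R-unique , cong suc length-R) , λ where
      (here refl)  → C∈𝓢
      (there X∈R) → R⊆𝓢 X∈R

  ∉⇒Yes-∁-minimalCover : ∀ {R S} → R ⊆ᴸ 𝓢 → S ∈ᴸ 𝓢 → S ∉ᴸ R → Any (λ A → Yes 𝓢 (∁ A)) (minimalCovers R)
  ∉⇒Yes-∁-minimalCover {R} {S} R⊆𝓢 S∈𝓢 S∉R with ∃-minimalCover-⊆ R (⊈⇒∁-cover R F⊈S)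
    where
    F⊈S : ∀ F → F ∈ᴸ R → ¬ F ⊆ S
    F⊈S F F∈R F⊆S = S∉R (subst (_∈ᴸ R) (proj₂ 𝓢-antichain F S (R⊆𝓢 F∈R) S∈𝓢 F⊆S) F∈R)
  ... | A , A-minimal , A⊆∁S =
    lose (Equivalence.from (∈-minimalCovers⇔ R A) A-minimal) (lose S∈𝓢 (p⊆∁q⇒q⊆∁p A⊆∁S))

  grow-learned : ∀ {j R} → suc j < k → Learned j R → Learned (suc j) (result (grow R (minimalCovers R)) 𝓢)
  grow-learned {j} {R} 1+j<k R-learned@((R-unique , length-R) , R⊆𝓢)
    with length-<⇒∃∉ (≡-dec _≟_) R-unique 𝓢-unique (subst₂ _<_ (sym length-R) (sym length-𝓢) 1+j<k)
  ... | S , S∈𝓢 , S∉R with grow-finds-member R (minimalCovers R) 𝓢 (∉⇒Yes-∁-minimalCover R⊆𝓢 S∈𝓢 S∉R)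
  ...   | A , C , A∈MC , C∈𝓢 , C⊆∁A , result≡C∷R rewrite result≡C∷R =
    learned-∷ R-learned C∈𝓢 (cover⇒⊆∁-∉ (proj₁ (Equivalence.to (∈-minimalCovers⇔ R A) A∈MC)) C⊆∁A)

  learn-learned : ∀ j → j < k → Learned j (result (learn j) 𝓢)
  learn-learned zero 0<k = subst (Learned 0) (sym (result-<$> (_∷ []) (minimalYes ⊤) 𝓢))
    ((All.[] ∷ [] , refl) , λ where
      (here refl) → proj₁ (minimalYes-∈ (nonempty⇒Yes-⊤ (subst (0 <_) (sym length-𝓢) 0<k))))
  learn-learned (suc j) 1+j<k rewrite result->>= (learn j) (λ R → grow R (minimalCovers R)) 𝓢 =
    grow-learned 1+j<k (learn-learned j (<⇒≤ 1+j<k))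

  learn-complete : ∀ j → suc j ≡ k → SameFamily (result (learn j) 𝓢) 𝓢
  learn-complete j 1+j≡k X with learn-learned j (≤-reflexive 1+j≡k)
  ... | (R-unique , length-R) , R⊆𝓢 = mk⇔ R⊆𝓢
    (unique-⊆∧length-≡⇒⊇ (≡-dec _≟_) R-unique 𝓢-unique R⊆𝓢 (trans length-R (trans 1+j≡k (sym length-𝓢))))

  learn-cost : ∀ (g : ℕ → ℕ) → (∀ m → IsMaxMC n m (g m)) →
    ∀ j → j < k → cost (learn j) 𝓢 ≤ sum1to g j + suc j * n
  learn-cost g g-max zero _ = begin
    cost ((_∷ []) <$> minimalYes ⊤) 𝓢 ≡⟨ cost-<$> (_∷ []) (minimalYes ⊤) 𝓢 ⟩
    cost (minimalYes ⊤) 𝓢              ≡⟨ cost-minimalYes ⊤ 𝓢 ⟩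
    n                                   ≡⟨ +-identityʳ n ⟨
    n + 0                               ∎
    where open ≤-Reasoning
  learn-cost g g-max (suc j) 1+j<k = begin
    cost (learn (suc j)) 𝓢                        ≡⟨ cost->>= (learn j) (λ R → grow R (minimalCovers R)) 𝓢 ⟩
    cost (learn j) 𝓢 + cost (grow R MC) 𝓢          ≤⟨ +-mono-≤ (learn-cost g g-max j (<⇒≤ 1+j<k)) (cost-grow R MC 𝓢) ⟩
    (sum1to g j + suc j * n) + (length MC + n)     ≤⟨ +-monoʳ-≤ (sum1to g j + suc j * n) (+-monoˡ-≤ n |MC|≤g) ⟩
    (sum1to g j + suc j * n) + (g (suc j) + n)     ≡⟨ interchange (sum1to g j) (suc j * n) (g (suc j)) n ⟩
    sum1to g (suc j) + (suc j * n + n)             ≡⟨ cong (sum1to g (suc j) +_) (+-comm (suc j * n) n) ⟩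
    sum1to g (suc j) + suc (suc j) * n             ∎
    where
    open ≤-Reasoning
    R : List (Subset n)
    R = result (learn j) 𝓢
    MC : List (Subset n)
    MC = minimalCovers R
    |MC|≤g : length MC ≤ g (suc j)
    |MC|≤g = proj₁ (g-max (suc j)) R _ (proj₁ (learn-learned j (<⇒≤ 1+j<k))) (minimalCovers-card R)

learn-determines : ∀ {n} j → Determines n (suc j) (strategy (learn j))
learn-determines j 𝓢 𝓢′ 𝓢-antichain 𝓢′-antichain same-answers X =
  ⇔.trans (⇔.sym (Learning.learn-complete 𝓢-antichain j refl X))
    (subst (λ R → X ∈ᴸ R ⇔ X ∈ᴸ 𝓢′) (sym (run-≡⇒result-≡ (learn j) same-answers))
      (Learning.learn-complete 𝓢′-antichain j refl X))

learn-within-budget : ∀ {n} (g : ℕ → ℕ) → (∀ m → IsMaxMC n m (g m)) → ∀ j 𝓢 → IsAntichain n (suc j) 𝓢 →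
  length (run (strategy (learn j)) 𝓢) ≤ sum1to g j + suc j * n
learn-within-budget g g-max j 𝓢 𝓢-antichain rewrite length-run (learn j) 𝓢 =
  Learning.learn-cost 𝓢-antichain g g-max j ≤-refl

theorem1p3 : (n k : ℕ) → 1 ≤ n → 1 ≤ k →
    (g : ℕ → ℕ) → (∀ m → IsMaxMC n m (g m)) →
    f≤ n k (sum1to g (k ∸ 1) + k * n)
theorem1p3 n (suc j) _ _ g g-max = strategy (learn j) , learn-determines j , learn-within-budget g g-max j
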